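{- Let $z\in\mathbb{C}$, $(b_k)_{k\ge1}$ complex numbers, and let $P(n)$ ($n\ge0$) and $F_k(n)$ ($n\ge1$, $1\le k\le n$) be complex numbers with $P(0)=1$ such that for all $n\ge1$ and $1\le i\le n$, $$F_i(n)=\sum_{j=1}^n a_i(j)P(n-j),\qquad a_i(j)=\begin{cases}b_iz^{r},& j=ri,\ r\ge1 \text{ an integer},\\0,&\text{otherwise},\end{cases}$$ and $\sum_{k=1}^nkF_k(n)=nP(n)$. Let $f:\mathbb{N}\to\mathbb{C}$ and $g(n)=\sum_{d\mid n}b_df(d)z^{n/d}$. Then for all $n\ge1$, $$\sum_{k=1}^ng(k)P(n-k)=\sum_{k=1}^nf(k)F_k(n),$$ and, as formal power series in $q$, with $Q(q)=\sum_{n\ge0}P(n)q^n$, $$Q(q)\sum_{k=1}^\infty g(k)q^k=\sum_{n=0}^\infty\Big(\sum_{k=1}^nf(k)F_k(n)\Big)q^n.$$ -}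

module Defs where

open import Level using (Level)
open import Algebra.Bundles using (CommutativeRing)
open import Data.Nat as ℕ using (ℕ; zero; suc; _∸_)
open import Data.Nat.Divisibility using (_∣?_)
open import Data.Nat.DivMod using (_/_)
open import Relation.Nullary using (yes; no)

-- Everything is stated over an arbitrary commutative ring R
-- (the paper's setting is R = ℂ).
module WithRing {c ℓ : Level} (R : CommutativeRing c ℓ) where
  open CommutativeRing R

  pow : Carrier → ℕ → Carrier
  pow x zero    = 1#
  pow x (suc r) = x * pow x r

  ι : ℕ → Carrier
  ι zero    = 0#
  ι (suc n) = 1# + ι n

  Σ1 : ℕ → (ℕ → Carrier) → Carrier
  Σ1 zero    h = 0#
  Σ1 (suc n) h = Σ1 n h + h (suc n)

  Σ0 : ℕ → (ℕ → Carrier) → Carrier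
  Σ0 n h = h 0 + Σ1 n h

  a : (b : ℕ → Carrier) (z : Carrier) → ℕ → ℕ → Carrier
  a b z zero     j       = 0#
  a b z (suc i') zero    = 0#
  a b z (suc i') (suc j') with suc i' ∣? suc j'
  ... | yes _ = b (suc i') * pow z (suc j' / suc i')
  ... | no  _ = 0#

  g : (b f : ℕ → Carrier) (z : Carrier) → ℕ → Carrier
  g b f z n = Σ1 n term
    where
    term : ℕ → Carrier
    term zero = 0#
    term (suc d') with suc d' ∣? n
    ... | yes _ = b (suc d') * f (suc d') * pow z (n / suc d')
    ... | no  _ = 0#

  FPS : Set c
  FPS = ℕ → Carrier

  _⋆_ : FPS → FPS → FPS
  (A ⋆ B) n = Σ0 n (λ k → A k * B (n ∸ k))

  Gseries : (b f : ℕ → Carrier) (z : Carrier) → FPS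
  Gseries b f z zero    = 0#
  Gseries b f z (suc k) = g b f z (suc k)

{-# OPTIONS --safe #-}
module Submission where

-- Writing g(k) = Σ_{d ≤ k} f(d) a_d(k) turns the left-hand side into the double sum
-- Σ_k Σ_d f(d) a_d(k) P(n − k); exchanging the order of summation gives
-- Σ_d f(d) Σ_k a_d(k) P(n − k) = Σ_d f(d) F_d(n). The power-series form is the same
-- identity read off coefficientwise, since the series Σ g(k) qᵏ has no constant term.

open import Defs
open import Algebra.Bundles using (CommutativeRing)
open import Data.Nat using (ℕ; zero; suc; _∸_; _≤_; _<_; _≤′_; ≤′-refl; ≤′-step; z≤n; s≤s)
open import Data.Nat.Properties using (≤-refl; ≤-trans; m≤n⇒m≤1+n; <⇒≱; ≤⇒≤′; ≤′⇒≤; m∸[m∸n]≡n)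
open import Data.Nat.Divisibility using (_∣?_; ∣⇒≤)
open import Data.Product using (_×_; _,_)
open import Data.Empty using (⊥-elim)
open import Relation.Nullary using (yes; no)
open import Relation.Binary.PropositionalEquality using (_≡_)

module FiniteSums {c ℓ} (R : CommutativeRing c ℓ) where
  open CommutativeRing R
  open WithRing R
  open import Relation.Binary.Reasoning.Setoid setoid

  Σ1-cong : ∀ n {h h′ : ℕ → Carrier} → (∀ k → 1 ≤ k → k ≤ n → h k ≈ h′ k) →
            Σ1 n h ≈ Σ1 n h′
  Σ1-cong zero    eq = refl
  Σ1-cong (suc n) eq =
    +-cong (Σ1-cong n (λ k 1≤k k≤n → eq k 1≤k (m≤n⇒m≤1+n k≤n))) (eq (suc n) (s≤s z≤n) ≤-refl)

  Σ0-cong : ∀ n {h h′ : ℕ → Carrier} → (∀ k → k ≤ n → h k ≈ h′ k) → Σ0 n h ≈ Σ0 n h′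
  Σ0-cong n eq = +-cong (eq 0 z≤n) (Σ1-cong n (λ k _ k≤n → eq k k≤n))

  Σ1-zero : ∀ n → Σ1 n (λ _ → 0#) ≈ 0#
  Σ1-zero zero    = refl
  Σ1-zero (suc n) = trans (+-identityʳ _) (Σ1-zero n)

  +-interchange : ∀ w x y z → (w + x) + (y + z) ≈ (w + y) + (x + z)
  +-interchange w x y z = begin
    (w + x) + (y + z) ≈⟨ +-assoc w x (y + z) ⟩
    w + (x + (y + z)) ≈⟨ +-congˡ (sym (+-assoc x y z)) ⟩
    w + ((x + y) + z) ≈⟨ +-congˡ (+-congʳ (+-comm x y)) ⟩
    w + ((y + x) + z) ≈⟨ +-congˡ (+-assoc y x z) ⟩
    w + (y + (x + z)) ≈⟨ sym (+-assoc w y (x + z)) ⟩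
    (w + y) + (x + z) ∎

  Σ1-distrib-+ : ∀ n (u v : ℕ → Carrier) → Σ1 n (λ k → u k + v k) ≈ Σ1 n u + Σ1 n v
  Σ1-distrib-+ zero    u v = sym (+-identityˡ 0#)
  Σ1-distrib-+ (suc n) u v = trans (+-congʳ (Σ1-distrib-+ n u v)) (+-interchange _ _ _ _)

  Σ1-*ˡ : ∀ n x (h : ℕ → Carrier) → x * Σ1 n h ≈ Σ1 n (λ k → x * h k)
  Σ1-*ˡ zero    x h = zeroʳ x
  Σ1-*ˡ (suc n) x h = trans (distribˡ x (Σ1 n h) (h (suc n))) (+-congʳ (Σ1-*ˡ n x h))

  Σ1-*ʳ : ∀ n x (h : ℕ → Carrier) → Σ1 n h * x ≈ Σ1 n (λ k → h k * x)
  Σ1-*ʳ zero    x h = zeroˡ x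
  Σ1-*ʳ (suc n) x h = trans (distribʳ x (Σ1 n h) (h (suc n))) (+-congʳ (Σ1-*ʳ n x h))

  Σ1-comm : ∀ m n (H : ℕ → ℕ → Carrier) →
            Σ1 m (λ i → Σ1 n (H i)) ≈ Σ1 n (λ j → Σ1 m (λ i → H i j))
  Σ1-comm zero    n H = sym (Σ1-zero n)
  Σ1-comm (suc m) n H = trans (+-congʳ (Σ1-comm m n H)) (sym (Σ1-distrib-+ n _ _))

  Σ1-extend : ∀ {m n} (h : ℕ → Carrier) → m ≤′ n → (∀ k → m < k → h k ≈ 0#) →
              Σ1 m h ≈ Σ1 n h
  Σ1-extend h ≤′-refl        vanish = refl
  Σ1-extend h (≤′-step m≤′n) vanish =
    trans (Σ1-extend h m≤′n vanish)
          (sym (trans (+-congˡ (vanish _ (s≤s (≤′⇒≤ m≤′n)))) (+-identityʳ _)))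

  Σ1-suc≈Σ0 : ∀ n (h : ℕ → Carrier) → Σ1 (suc n) h ≈ Σ0 n (λ k → h (suc k))
  Σ1-suc≈Σ0 zero    h = +-comm _ _
  Σ1-suc≈Σ0 (suc n) h = trans (+-congʳ (Σ1-suc≈Σ0 n h)) (+-assoc _ _ _)

  Σ0-reverse : ∀ n (h : ℕ → Carrier) → Σ0 n h ≈ Σ0 n (λ k → h (n ∸ k))
  Σ0-reverse zero    h = refl
  Σ0-reverse (suc n) h = begin
    h 0 + (Σ1 n h + h (suc n))         ≈⟨ sym (+-assoc _ _ _) ⟩
    Σ0 n h + h (suc n)                 ≈⟨ +-congʳ (Σ0-reverse n h) ⟩
    Σ0 n (λ k → h (n ∸ k)) + h (suc n) ≈⟨ +-comm _ _ ⟩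
    h (suc n) + Σ0 n (λ k → h (n ∸ k)) ≈⟨ +-congˡ (sym (Σ1-suc≈Σ0 n (λ k → h (suc n ∸ k)))) ⟩
    h (suc n) + Σ1 (suc n) (λ k → h (suc n ∸ k)) ∎

  ⋆-comm : ∀ (A B : FPS) n → (A ⋆ B) n ≈ (B ⋆ A) n
  ⋆-comm A B n = begin
    (A ⋆ B) n                              ≈⟨ Σ0-reverse n (λ k → A k * B (n ∸ k)) ⟩
    Σ0 n (λ k → A (n ∸ k) * B (n ∸ (n ∸ k))) ≈⟨ Σ0-cong n swap ⟩
    (B ⋆ A) n                              ∎
    where
    swap : ∀ k → k ≤ n → A (n ∸ k) * B (n ∸ (n ∸ k)) ≈ B k * A (n ∸ k)
    swap k k≤n with n ∸ (n ∸ k) | m∸[m∸n]≡n k≤n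
    ... | .k | _≡_.refl = *-comm _ _

module DivisorSums {c ℓ} (R : CommutativeRing c ℓ) (b f : ℕ → CommutativeRing.Carrier R) (z : CommutativeRing.Carrier R) where
  open CommutativeRing R
  open WithRing R
  open FiniteSums R
  open import Relation.Binary.Reasoning.Setoid setoid

  a-vanishes-below : ∀ i j → j < i → a b z i j ≈ 0#
  a-vanishes-below (suc i) zero    _ = refl
  a-vanishes-below (suc i) (suc j) j<i with suc i ∣? suc j
  ... | yes i∣j = ⊥-elim (<⇒≱ j<i (∣⇒≤ i∣j))
  ... | no  _   = refl

  g≈Σ-f*a : ∀ k → 1 ≤ k → g b f z k ≈ Σ1 k (λ d → f d * a b z d k)
  g≈Σ-f*a (suc k) _ = Σ1-cong (suc k) {h = term} term≈f*a
    where
    -- The summand of g is local to its where block; unification recovers it.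
    term : ℕ → Carrier
    term = _
    g-unfold : g b f z (suc k) ≡ Σ1 (suc k) term
    g-unfold = _≡_.refl

    term≈f*a : ∀ d → 1 ≤ d → d ≤ suc k → term d ≈ f d * a b z d (suc k)
    term≈f*a (suc d) _ _ with suc d ∣? suc k
    ... | yes _ = trans (*-congʳ (*-comm _ _)) (*-assoc _ _ _)
    ... | no  _ = sym (zeroʳ _)

  g≈Σ-upto : ∀ {k n} → 1 ≤ k → k ≤ n → g b f z k ≈ Σ1 n (λ d → f d * a b z d k)
  g≈Σ-upto {k} 1≤k k≤n =
    trans (g≈Σ-f*a k 1≤k)
          (Σ1-extend _ (≤⇒≤′ k≤n) (λ d k<d → trans (*-congˡ (a-vanishes-below d k k<d)) (zeroʳ _)))

  module _ (P : ℕ → Carrier) (F : ℕ → ℕ → Carrier)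
           (F-def : ∀ n i → 1 ≤ n → 1 ≤ i → i ≤ n → F i n ≈ Σ1 n (λ j → a b z i j * P (n ∸ j)))
           where

    Σ-g*P≈Σ-f*F : ∀ n → Σ1 n (λ k → g b f z k * P (n ∸ k)) ≈ Σ1 n (λ k → f k * F k n)
    Σ-g*P≈Σ-f*F n = begin
      Σ1 n (λ k → g b f z k * P (n ∸ k))
        ≈⟨ Σ1-cong n (λ k 1≤k k≤n → *-congʳ (g≈Σ-upto 1≤k k≤n)) ⟩
      Σ1 n (λ k → Σ1 n (λ d → f d * a b z d k) * P (n ∸ k))
        ≈⟨ Σ1-cong n (λ k _ _ → Σ1-*ʳ n _ _) ⟩
      Σ1 n (λ k → Σ1 n (λ d → f d * a b z d k * P (n ∸ k)))
        ≈⟨ Σ1-comm n n _ ⟩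
      Σ1 n (λ d → Σ1 n (λ k → f d * a b z d k * P (n ∸ k)))
        ≈⟨ Σ1-cong n (λ d _ _ → Σ1-cong n (λ k _ _ → *-assoc _ _ _)) ⟩
      Σ1 n (λ d → Σ1 n (λ k → f d * (a b z d k * P (n ∸ k))))
        ≈⟨ Σ1-cong n (λ d _ _ → sym (Σ1-*ˡ n _ _)) ⟩
      Σ1 n (λ d → f d * Σ1 n (λ k → a b z d k * P (n ∸ k)))
        ≈⟨ Σ1-cong n (λ d 1≤d d≤n → *-congˡ (sym (F-def n d (≤-trans 1≤d d≤n) 1≤d d≤n))) ⟩
      Σ1 n (λ k → f k * F k n) ∎

    P⋆G≈Σ-f*F : ∀ n → (P ⋆ Gseries b f z) n ≈ Σ1 n (λ k → f k * F k n)
    P⋆G≈Σ-f*F n = begin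
      (P ⋆ Gseries b f z) n                              ≈⟨ ⋆-comm P (Gseries b f z) n ⟩
      0# * P n + Σ1 n (λ k → Gseries b f z k * P (n ∸ k)) ≈⟨ +-cong (zeroˡ _) (Σ1-cong n G≈g) ⟩
      0# + Σ1 n (λ k → g b f z k * P (n ∸ k))            ≈⟨ +-identityˡ _ ⟩
      Σ1 n (λ k → g b f z k * P (n ∸ k))                 ≈⟨ Σ-g*P≈Σ-f*F n ⟩
      Σ1 n (λ k → f k * F k n)                           ∎
      where
      G≈g : ∀ k → 1 ≤ k → k ≤ n → Gseries b f z k * P (n ∸ k) ≈ g b f z k * P (n ∸ k)
      G≈g (suc k) _ _ = refl

proposition3p1 : ∀ {c ℓ} (R : CommutativeRing c ℓ) →
    let open CommutativeRing R in let open WithRing R in (z : Carrier) (b : ℕ → Carrier) (P : ℕ → Carrier) (F : ℕ → ℕ → Carrier) →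
       P 0 ≈ 1# →
       (∀ n i → 1 ≤ n → 1 ≤ i → i ≤ n → F i n ≈ Σ1 n (λ j → a b z i j * P (n ∸ j))) →
       (∀ n → 1 ≤ n → Σ1 n (λ k → ι k * F k n) ≈ ι n * P n) →
       (f : ℕ → Carrier) →
       (∀ n → 1 ≤ n →
          Σ1 n (λ k → g b f z k * P (n ∸ k)) ≈ Σ1 n (λ k → f k * F k n))
       ×
       (∀ n →
          (P ⋆ Gseries b f z) n
            ≈ Σ1 n (λ k → f k * F k n))
proposition3p1 R z b P F _ F-def _ f =
  (λ n _ → Σ-g*P≈Σ-f*F P F F-def n) , P⋆G≈Σ-f*F P F F-def
  where open DivisorSums R b f z
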